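{- QHC is a conservative extension of QH, where formulas of QH are identified with i-formulas of QHC containing no occurrences of $?$ and $!$. That is, for every rule or principle $R$ whose formulas are formulas of QH, $\vdash_{QHC}R$ holds if and only if $\vdash_{QH}R$.
   Context: Meta-logical framework. Formulas of a first-order language may contain individual variables and predicate variables. Meta-formulas are built from formulas using meta-conjunction $\&$, meta-implication $\Rightarrow$, and universal meta-quantifiers over individual and predicate variables. A principle $\cdot G$, for a formula $G$, is the meta-formula obtained by universally meta-quantifying all free individual variables of $G$ and then all predicate variables of $G$. A rule $F_1,\dots,F_m/G$ is the meta-formula $\forall^2(\forall^1F_1\,\&\cdots\&\,\forall^1F_m\Rightarrow\forall^1G)$, where $\forall^1$ meta-quantifies the free individual variables of the formula it precedes and $\forall^2$ meta-quantifies all predicate variables occurring. A logic $L$ is given by a derivation system $\mathcal D$, a meta-conjunction of finitely many principles and rules. For a meta-formula $\mathcal F$, $\vdash_L\mathcal F$ means that $\mathcal D\Rightarrow\mathcal F$ is derivable by the natural-deduction meta-rules: introduction and elimination of $\&$, $\Rightarrow$ and the universal meta-quantifiers (elimination allows substituting terms for individual variables and formulas for predicate variables), plus $\alpha$-conversion. Language of QHC. It has individual variables and, for each $n\ge0$, countably many $n$-ary problem variables $\alpha,\beta,\gamma,\delta,\theta,\dots$ and countably many $n$-ary proper predicate variables $p,q,\dots$. - A c-formula is $\top$, $\bot$, an atom $p(x_1,\dots,x_n)$, or $?\Phi$ for an i-formula $\Phi$, closed under the classical connectives $\land,\lor,\to,\leftrightarrow,\neg$ and quantifiers $\exists,\forall$.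 - An i-formula is $\checkmark$ (triviality), $\curlywedge$ (absurdity), an atom $\alpha(x_1,\dots,x_n)$, or $!F$ for a c-formula $F$, closed under the intuitionistic connectives $\land,\lor,\to,\leftrightarrow,\neg$ (with $\neg\Phi:=\Phi\to\curlywedge$) and quantifiers $\exists,\forall$. Connectives applied to c-formulas are classical; those applied to i-formulas are intuitionistic. QHC is the logic whose derivation system consists of: - (0a) all laws and rules of classical predicate logic QC, for c-formulas; - (0b) all laws and rules of intuitionistic predicate logic QH, for i-formulas; - the principles $\cdot\,?(\gamma\land\delta)\leftrightarrow ?\gamma\land ?\delta$, $\cdot\,?(\gamma\lor\delta)\leftrightarrow ?\gamma\lor ?\delta$, $\cdot\,?(\gamma\to\delta)\to(?\gamma\to ?\delta)$, $\cdot\,\neg ?\curlywedge$, $\cdot\,?\exists x\,\theta(x)\leftrightarrow\exists x\,?\theta(x)$, $\cdot\,?\forall x\,\theta(x)\to\forall x\,?\theta(x)$, $\cdot\,\gamma\to\,!?\gamma$, $\cdot\,\neg !\bot$, $\cdot\,?!p\to p$, $\cdot\,!p\to\,!?!p$ and $\cdot\,!(p\to q)\to(!p\to !q)$; - the rules $!p/p$ and $p/!p$. -}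

module Defs where

-- Everything uses de Bruijn indices: individual variables are Fin n,
-- predicate variables are typed de Bruijn indices into a predicate context
-- (a list of (sort , arity)).  alpha-conversion is therefore built in.

open import Data.Nat using (ℕ; zero; suc; _+_)
open import Data.Fin using (Fin; zero; suc; splitAt; _↑ˡ_)
open import Data.Vec using (Vec; []; _∷_; lookup; tabulate)
import Data.Vec as Vec
open import Data.List using (List; []; _∷_)
import Data.List as List
open import Data.List.Relation.Unary.All using (All; []; _∷_)
import Data.List.Relation.Unary.All as All
open import Data.List.Membership.Propositional using (_∈_)
open import Data.Product using (Σ; _×_; _,_; proj₁; proj₂)
open import Data.Sum using ([_,_])
open import Function using (_∘_; id)

-- csort : c-formulas / proper predicate variables (classical)
-- isort : i-formulas / problem variables (intuitionistic)
data Sort : Set where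
  csort isort : Sort

data Lang : Set where
  QH QHC : Lang

data HasSort : Lang → Sort → Set where
  qh-i  : HasSort QH isort
  qhc-c : HasSort QHC csort
  qhc-i : HasSort QHC isort

PCtx : Set
PCtx = List (Sort × ℕ)

data Var : PCtx → Sort → ℕ → Set where
  vz : ∀ {Δ s a} → Var ((s , a) ∷ Δ) s a
  vs : ∀ {Δ k s a} → Var Δ s a → Var (k ∷ Δ) s a

-- Fm L s n Δ : formulas of sort s in language L with free
-- individual variables among Fin n and predicate variables from Δ.
-- tru/fls are ⊤/⊥ for c-formulas and ✓/⋏ for i-formulas; the
-- connectives are classical on c-formulas and intuitionistic on
-- i-formulas (their meaning is fixed by the derivation systems below).

infixr 6 _⋀_
infixr 5 _⋁_
infixr 4 _⟶_ _⟷_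

data Fm : Lang → Sort → ℕ → PCtx → Set where
  tru fls   : ∀ {L s n Δ} → Fm L s n Δ
  atom      : ∀ {L s n Δ a} → Var Δ s a → Vec (Fin n) a → Fm L s n Δ
  _⋀_ _⋁_ _⟶_ : ∀ {L s n Δ} → Fm L s n Δ → Fm L s n Δ → Fm L s n Δ
  ex fa     : ∀ {L s n Δ} → Fm L s (suc n) Δ → Fm L s n Δ
  que       : ∀ {n Δ} → Fm QHC isort n Δ → Fm QHC csort n Δ
  bang      : ∀ {n Δ} → Fm QHC csort n Δ → Fm QHC isort n Δ

neg : ∀ {L s n Δ} → Fm L s n Δ → Fm L s n Δ
neg A = A ⟶ fls

_⟷_ : ∀ {L s n Δ} → Fm L s n Δ → Fm L s n Δ → Fm L s n Δ
A ⟷ B = (A ⟶ B) ⋀ (B ⟶ A)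

-- Renaming of individual variables (terms are just variables, so this is
-- also substitution of terms for individual variables).

Ren : ℕ → ℕ → Set
Ren n m = Fin n → Fin m

liftR : ∀ {n m} → Ren n m → Ren (suc n) (suc m)
liftR ρ zero    = zero
liftR ρ (suc i) = suc (ρ i)

ren : ∀ {L s n m Δ} → Ren n m → Fm L s n Δ → Fm L s m Δ
ren ρ tru        = tru
ren ρ fls        = fls
ren ρ (atom x t) = atom x (Vec.map ρ t)
ren ρ (A ⋀ B)    = ren ρ A ⋀ ren ρ B
ren ρ (A ⋁ B)    = ren ρ A ⋁ ren ρ B
ren ρ (A ⟶ B)    = ren ρ A ⟶ ren ρ B
ren ρ (ex A)     = ex (ren (liftR ρ) A)
ren ρ (fa A)     = fa (ren (liftR ρ) A)
ren ρ (que A)    = que (ren ρ A)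
ren ρ (bang A)   = bang (ren ρ A)

PRen : PCtx → PCtx → Set
PRen Δ Δ' = ∀ {s a} → Var Δ s a → Var Δ' s a

pren : ∀ {L s n Δ Δ'} → PRen Δ Δ' → Fm L s n Δ → Fm L s n Δ'
pren π tru        = tru
pren π fls        = fls
pren π (atom x t) = atom (π x) t
pren π (A ⋀ B)    = pren π A ⋀ pren π B
pren π (A ⋁ B)    = pren π A ⋁ pren π B
pren π (A ⟶ B)    = pren π A ⟶ pren π B
pren π (ex A)     = ex (pren π A)
pren π (fa A)     = fa (pren π A)
pren π (que A)    = que (pren π A)
pren π (bang A)   = bang (pren π A)

liftP : ∀ {Δ Δ' k} → PRen Δ Δ' → PRen (k ∷ Δ) (k ∷ Δ')
liftP π vz     = vz
liftP π (vs x) = vs (π x)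

-- An a-ary variable is
-- replaced by a formula in context (a + n): the first a individual
-- variables are the argument places, the remaining n are parameters.
PSub : Lang → PCtx → PCtx → ℕ → Set
PSub L Δ Δ' n = ∀ {s a} → Var Δ s a → Fm L s (a + n) Δ'

-- psub σ w A : w tells where the parameters (Fin n) live in the current
-- context m (it is shifted under binders, so no capture occurs).
psub : ∀ {L s n m Δ Δ'} → PSub L Δ Δ' n → Ren n m → Fm L s m Δ → Fm L s m Δ'
psub σ w tru                  = tru
psub σ w fls                  = fls
psub σ w (atom {a = a} x t)   = ren ([ lookup t , w ] ∘ splitAt a) (σ x)
psub σ w (A ⋀ B)              = psub σ w A ⋀ psub σ w B
psub σ w (A ⋁ B)              = psub σ w A ⋁ psub σ w B
psub σ w (A ⟶ B)              = psub σ w A ⟶ psub σ w B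
psub σ w (ex A)               = ex (psub σ (suc ∘ w) A)
psub σ w (fa A)               = fa (psub σ (suc ∘ w) A)
psub σ w (que A)              = que (psub σ w A)
psub σ w (bang A)             = bang (psub σ w A)

idS : ∀ {L Δ n} → PSub L Δ Δ n
idS {n = n} x = atom x (tabulate (_↑ˡ n))

liftS : ∀ {L Δ Δ' n k} → PSub L Δ Δ' n → PSub L (k ∷ Δ) (k ∷ Δ') n
liftS {n = n} σ vz = atom vz (tabulate (_↑ˡ n))
liftS σ (vs x)     = pren vs (σ x)

single : ∀ {L Δ n s a} → Fm L s (a + n) Δ → PSub L ((s , a) ∷ Δ) Δ n
single A vz     = A
single A (vs x) = idS x

infixr 3 _&_
infixr 2 _⇒_

data MF (L : Lang) : ℕ → PCtx → Set where
  fm  : ∀ {s n Δ} → HasSort L s → Fm L s n Δ → MF L n Δ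
  _&_ : ∀ {n Δ} → MF L n Δ → MF L n Δ → MF L n Δ
  _⇒_ : ∀ {n Δ} → MF L n Δ → MF L n Δ → MF L n Δ
  Π¹  : ∀ {n Δ} → MF L (suc n) Δ → MF L n Δ
  Π²  : ∀ {s n Δ} → HasSort L s → (a : ℕ) → MF L n ((s , a) ∷ Δ) → MF L n Δ

mren : ∀ {L n m Δ} → Ren n m → MF L n Δ → MF L m Δ
mren ρ (fm h A)    = fm h (ren ρ A)
mren ρ (M & N)     = mren ρ M & mren ρ N
mren ρ (M ⇒ N)     = mren ρ M ⇒ mren ρ N
mren ρ (Π¹ M)      = Π¹ (mren (liftR ρ) M)
mren ρ (Π² h a M)  = Π² h a (mren ρ M)

mpren : ∀ {L n Δ Δ'} → PRen Δ Δ' → MF L n Δ → MF L n Δ'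
mpren π (fm h A)   = fm h (pren π A)
mpren π (M & N)    = mpren π M & mpren π N
mpren π (M ⇒ N)    = mpren π M ⇒ mpren π N
mpren π (Π¹ M)     = Π¹ (mpren π M)
mpren π (Π² h a M) = Π² h a (mpren (liftP π) M)

mpsub : ∀ {L n m Δ Δ'} → PSub L Δ Δ' n → Ren n m → MF L m Δ → MF L m Δ'
mpsub σ w (fm h A)   = fm h (psub σ w A)
mpsub σ w (M & N)    = mpsub σ w M & mpsub σ w N
mpsub σ w (M ⇒ N)    = mpsub σ w M ⇒ mpsub σ w N
mpsub σ w (Π¹ M)     = Π¹ (mpsub σ (suc ∘ w) M)
mpsub σ w (Π² h a M) = Π² h a (mpsub (liftS σ) w M)

inst : ∀ {n} → Fin n → Ren (suc n) n
inst t zero    = t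
inst t (suc j) = j

infix 1 _⊢_

data _⊢_ {L : Lang} : ∀ {n Δ} → List (MF L n Δ) → MF L n Δ → Set where
  hyp  : ∀ {n Δ} {Γ : List (MF L n Δ)} {M} → M ∈ Γ → Γ ⊢ M
  &I   : ∀ {n Δ} {Γ : List (MF L n Δ)} {M N} → Γ ⊢ M → Γ ⊢ N → Γ ⊢ M & N
  &E₁  : ∀ {n Δ} {Γ : List (MF L n Δ)} {M N} → Γ ⊢ M & N → Γ ⊢ M
  &E₂  : ∀ {n Δ} {Γ : List (MF L n Δ)} {M N} → Γ ⊢ M & N → Γ ⊢ N
  ⇒I   : ∀ {n Δ} {Γ : List (MF L n Δ)} {M N} → (M ∷ Γ) ⊢ N → Γ ⊢ M ⇒ N
  ⇒E   : ∀ {n Δ} {Γ : List (MF L n Δ)} {M N} → Γ ⊢ M ⇒ N → Γ ⊢ M → Γ ⊢ N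
  Π¹I  : ∀ {n Δ} {Γ : List (MF L n Δ)} {M} →
         List.map (mren suc) Γ ⊢ M → Γ ⊢ Π¹ M
  Π¹E  : ∀ {n Δ} {Γ : List (MF L n Δ)} {M} →
         Γ ⊢ Π¹ M → (t : Fin n) → Γ ⊢ mren (inst t) M
  Π²I  : ∀ {n Δ s} {Γ : List (MF L n Δ)} {h : HasSort L s} {a} {M} →
         List.map (mpren vs) Γ ⊢ M → Γ ⊢ Π² h a M
  Π²E  : ∀ {n Δ s} {Γ : List (MF L n Δ)} {h : HasSort L s} {a} {M} →
         Γ ⊢ Π² h a M → (A : Fm L s (a + n) Δ) → Γ ⊢ mpsub (single A) id M

close¹ : ∀ {L n Δ} → MF L n Δ → MF L 0 Δ
close¹ {n = zero}  M = M
close¹ {n = suc n} M = close¹ (Π¹ M)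

OkCtx : Lang → PCtx → Set
OkCtx L Δ = All (λ k → HasSort L (proj₁ k)) Δ

close² : ∀ {L Δ} → OkCtx L Δ → MF L 0 Δ → MF L 0 []
close² []       M = M
close² (h ∷ hs) M = close² hs (Π² h _ M)

SFm : Lang → PCtx → Set
SFm L Δ = Σ ℕ λ n → Σ Sort λ s → HasSort L s × Fm L s n Δ

∀¹ : ∀ {L Δ} → SFm L Δ → MF L 0 Δ
∀¹ (n , s , h , A) = close¹ (fm h A)

conj : ∀ {L n Δ} → MF L n Δ → List (MF L n Δ) → MF L n Δ
conj M []       = M
conj M (N ∷ Ns) = M & conj N Ns

principle : ∀ {L Δ} → OkCtx L Δ → SFm L Δ → MF L 0 []
principle ok G = close² ok (∀¹ G)

-- rule F₁,…,Fₘ / G  =  ∀²(∀¹F₁ & ⋯ & ∀¹Fₘ ⇒ ∀¹G)   (m = 0 gives ·G)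
rule : ∀ {L Δ} → OkCtx L Δ → List (SFm L Δ) → SFm L Δ → MF L 0 []
rule ok []       G = principle ok G
rule ok (F ∷ Fs) G = close² ok (conj (∀¹ F) (List.map ∀¹ Fs) ⇒ ∀¹ G)

private
  v0 : ∀ {Δ s a} → Var ((s , a) ∷ Δ) s a
  v0 = vz
  v1 : ∀ {Δ k s a} → Var (k ∷ (s , a) ∷ Δ) s a
  v1 = vs vz
  v2 : ∀ {Δ k k' s a} → Var (k ∷ k' ∷ (s , a) ∷ Δ) s a
  v2 = vs (vs vz)

  p0 : ∀ {L n Δ s} → Fm L s n ((s , 0) ∷ Δ)
  p0 = atom v0 []
  p1 : ∀ {L n Δ k s} → Fm L s n (k ∷ (s , 0) ∷ Δ)
  p1 = atom v1 []
  p2 : ∀ {L n Δ k k' s} → Fm L s n (k ∷ k' ∷ (s , 0) ∷ Δ)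
  p2 = atom v2 []

  P1 : ∀ {L s} → HasSort L s → Fm L s 0 ((s , 0) ∷ []) → MF L 0 []
  P1 h G = principle (h ∷ []) (0 , _ , h , G)
  P2 : ∀ {L s} → HasSort L s → Fm L s 0 ((s , 0) ∷ (s , 0) ∷ []) → MF L 0 []
  P2 h G = principle (h ∷ h ∷ []) (0 , _ , h , G)
  P3 : ∀ {L s} → HasSort L s →
       Fm L s 0 ((s , 0) ∷ (s , 0) ∷ (s , 0) ∷ []) → MF L 0 []
  P3 h G = principle (h ∷ h ∷ h ∷ []) (0 , _ , h , G)

  x0 : ∀ {n} → Fin (suc n)
  x0 = zero

-- A standard finite Hilbert-style axiomatization of intuitionistic
-- predicate logic, written as principles and rules in sort s.
-- (For s = csort these are the intuitionistic part of QC.)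
Dint : ∀ {L s} → HasSort L s → MF L 0 []
Dint {L} {s} h = conj
  (P2 h (p0 ⟶ p1 ⟶ p0))
  ( P3 h ((p0 ⟶ p1 ⟶ p2) ⟶ (p0 ⟶ p1) ⟶ p0 ⟶ p2)
  ∷ P2 h (p0 ⋀ p1 ⟶ p0)
  ∷ P2 h (p0 ⋀ p1 ⟶ p1)
  ∷ P2 h (p0 ⟶ p1 ⟶ p0 ⋀ p1)
  ∷ P2 h (p0 ⟶ p0 ⋁ p1)
  ∷ P2 h (p1 ⟶ p0 ⋁ p1)
  ∷ P3 h ((p0 ⟶ p2) ⟶ (p1 ⟶ p2) ⟶ p0 ⋁ p1 ⟶ p2)
  ∷ P1 h (fls ⟶ p0)
  ∷ principle [] (0 , s , h , tru)
  -- ∀x θ(x) → θ(y)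
  ∷ principle (h ∷ []) (1 , s , h ,
      (fa (atom v0 (x0 ∷ [])) ⟶ atom {s = s} {a = 1} v0 (x0 ∷ [])))
  -- θ(y) → ∃x θ(x)
  ∷ principle (h ∷ []) (1 , s , h ,
      (atom {s = s} {a = 1} v0 (x0 ∷ []) ⟶ ex (atom v0 (x0 ∷ []))))
  ∷ rule (h ∷ h ∷ []) ((0 , s , h , p0) ∷ (0 , s , h , (p0 ⟶ p1)) ∷ [])
         (0 , s , h , p1)
  -- γ → θ(x) / γ → ∀x θ(x)
  ∷ rule (h ∷ h ∷ [])
         ((1 , s , h , (atom v0 [] ⟶ atom {a = 1} v1 (x0 ∷ []))) ∷ [])
         (0 , s , h , (atom v0 [] ⟶ fa (atom {a = 1} v1 (x0 ∷ []))))
  -- θ(x) → γ / ∃x θ(x) → γ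
  ∷ rule (h ∷ h ∷ [])
         ((1 , s , h , (atom {a = 1} v1 (x0 ∷ []) ⟶ atom v0 [])) ∷ [])
         (0 , s , h , (ex (atom {a = 1} v1 (x0 ∷ [])) ⟶ atom v0 []))
  ∷ [])

Dcl : ∀ {L s} → HasSort L s → MF L 0 []
Dcl h = Dint h & P1 h (neg (neg p0) ⟶ p0)

DQHC : MF QHC 0 []
DQHC = conj
  (P2c (que (p0 ⋀ p1) ⟷ que p0 ⋀ que p1))
  ( P2c (que (p0 ⋁ p1) ⟷ que p0 ⋁ que p1)
  ∷ P2c (que (p0 ⟶ p1) ⟶ (que p0 ⟶ que p1))
  ∷ principle [] (0 , csort , qhc-c , neg (que fls))
  -- ?∃x θ(x) ↔ ∃x ?θ(x)
  ∷ principle (qhc-i ∷ []) (0 , csort , qhc-c ,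
      (que (ex (atom {a = 1} v0 (x0 ∷ []))) ⟷ ex (que (atom v0 (x0 ∷ [])))))
  -- ?∀x θ(x) → ∀x ?θ(x)
  ∷ principle (qhc-i ∷ []) (0 , csort , qhc-c ,
      (que (fa (atom {a = 1} v0 (x0 ∷ []))) ⟶ fa (que (atom v0 (x0 ∷ [])))))
  ∷ principle (qhc-i ∷ []) (0 , isort , qhc-i , (p0 ⟶ bang (que p0)))
  ∷ principle [] (0 , isort , qhc-i , neg (bang fls))
  ∷ principle (qhc-c ∷ []) (0 , csort , qhc-c , (que (bang p0) ⟶ p0))
  ∷ principle (qhc-c ∷ []) (0 , isort , qhc-i ,
      (bang p0 ⟶ bang (que (bang p0))))
  ∷ principle (qhc-c ∷ qhc-c ∷ []) (0 , isort , qhc-i ,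
      (bang (p0 ⟶ p1) ⟶ (bang p0 ⟶ bang p1)))
  ∷ rule (qhc-c ∷ []) ((0 , isort , qhc-i , bang p0) ∷ [])
         (0 , csort , qhc-c , p0)
  ∷ rule (qhc-c ∷ []) ((0 , csort , qhc-c , p0) ∷ [])
         (0 , isort , qhc-i , bang p0)
  ∷ [])
  where
  P2c : Fm QHC csort 0 ((isort , 0) ∷ (isort , 0) ∷ []) → MF QHC 0 []
  P2c G = principle (qhc-i ∷ qhc-i ∷ []) (0 , csort , qhc-c , G)

D : (L : Lang) → MF L 0 []
D QH  = Dint qh-i
D QHC = Dcl qhc-c & Dint qhc-i & DQHC

-- A derivation may use
-- finitely many free individual variables (as in named-variable natural
-- deduction, where variables are always available), hence the k.
Prov : (L : Lang) → MF L 0 [] → Set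
Prov L F = Σ ℕ λ k → [] ⊢ mren {m = k} (λ ()) (D L ⇒ F)

embS : ∀ {s} → HasSort QH s → HasSort QHC s
embS qh-i = qhc-i

emb : ∀ {s n Δ} → Fm QH s n Δ → Fm QHC s n Δ
emb tru        = tru
emb fls        = fls
emb (atom x t) = atom x t
emb (A ⋀ B)    = emb A ⋀ emb B
emb (A ⋁ B)    = emb A ⋁ emb B
emb (A ⟶ B)    = emb A ⟶ emb B
emb (ex A)     = ex (emb A)
emb (fa A)     = fa (emb A)

embOk : ∀ {Δ} → OkCtx QH Δ → OkCtx QHC Δ
embOk = All.map embS

QHFm : PCtx → Set
QHFm Δ = Σ ℕ λ n → Fm QH isort n Δ

asQH : ∀ {Δ} → QHFm Δ → SFm QH Δ
asQH (n , A) = n , isort , qh-i , A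

asQHC : ∀ {Δ} → QHFm Δ → SFm QHC Δ
asQHC (n , A) = n , isort , qhc-i , emb A

module Submission where

-- QH-derivations embed into QHC, whose derivation system contains a copy of
-- that of QH.  Conversely, let τ translate QHC into QH: Kuroda's negative
-- translation on c-formulas (¬¬ in front and after every ∀), ? erased, !F read
-- as ¬¬F, and every predicate variable turned into a problem variable.  τ
-- commutes with substitution, so it maps meta-derivations to meta-derivations;
-- it is the identity on QH-formulas; and it sends every principle and rule of
-- QHC to one derivable in QH (the QHC-specific ones become instances of
-- A ⟶ A, A ⟶ ¬¬A, ¬¬(¬¬A ⟶ A) and ¬¬⊥ ⟶ ⊥).

open import Defs
open import Data.List using (List; map)
open import Data.Product using (_×_)
open import Function using (_⇔_)

open import Data.Nat using (_+_)
import Data.Nat as ℕ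
open import Data.Fin using (zero; suc; splitAt; _↑ˡ_)
open import Data.Fin.Properties using (splitAt-↑ˡ)
open import Data.Vec using ([]; _∷_; lookup; tabulate)
import Data.Vec as Vec
import Data.Vec.Properties as Vec
open import Data.List using ([]; _∷_)
import Data.List.Properties as List
open import Data.List.Relation.Unary.All using ([]; _∷_)
open import Data.List.Relation.Unary.Any using (here; there)
open import Data.List.Membership.Propositional using (_∈_)
open import Data.List.Membership.Propositional.Properties using (∈-map⁺)
open import Data.List.Relation.Binary.Subset.Propositional using (_⊆_)
import Data.List.Relation.Binary.Subset.Propositional.Properties as ⊆
open import Data.Product using (_,_)
open import Data.Sum using ([_,_])
open import Function using (_∘_; id; mk⇔)
open import Relation.Binary.PropositionalEquality hiding ([_])

map-commute : ∀ {A B C D : Set} {f : B → C} {g : A → B} {g' : D → C} {f' : A → D} →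
  (∀ x → f (g x) ≡ g' (f' x)) → ∀ xs → map f (map g xs) ≡ map g' (map f' xs)
map-commute e xs = trans (sym (List.map-∘ xs)) (trans (List.map-cong e xs) (List.map-∘ xs))

liftR-≗id : ∀ {n} {ρ : Ren n n} → (∀ i → ρ i ≡ i) → ∀ i → liftR ρ i ≡ i
liftR-≗id e zero    = refl
liftR-≗id e (suc i) = cong suc (e i)

ren-≗id : ∀ {L s n Δ} {ρ : Ren n n} → (∀ i → ρ i ≡ i) → (A : Fm L s n Δ) → ren ρ A ≡ A
ren-≗id e tru        = refl
ren-≗id e fls        = refl
ren-≗id e (atom x t) = cong (atom x) (trans (Vec.map-cong e t) (Vec.map-id t))
ren-≗id e (A ⋀ B)    = cong₂ _⋀_ (ren-≗id e A) (ren-≗id e B)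
ren-≗id e (A ⋁ B)    = cong₂ _⋁_ (ren-≗id e A) (ren-≗id e B)
ren-≗id e (A ⟶ B)    = cong₂ _⟶_ (ren-≗id e A) (ren-≗id e B)
ren-≗id e (ex A)     = cong ex (ren-≗id (liftR-≗id e) A)
ren-≗id e (fa A)     = cong fa (ren-≗id (liftR-≗id e) A)
ren-≗id e (que A)    = cong que (ren-≗id e A)
ren-≗id e (bang A)   = cong bang (ren-≗id e A)

ren-id : ∀ {L s n Δ} (A : Fm L s n Δ) → ren id A ≡ A
ren-id = ren-≗id (λ _ → refl)

pren-ren : ∀ {L s n m Δ Δ'} (ρ : Ren n m) (π : PRen Δ Δ') (A : Fm L s n Δ) →
  pren π (ren ρ A) ≡ ren ρ (pren π A)
pren-ren ρ π tru        = refl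
pren-ren ρ π fls        = refl
pren-ren ρ π (atom x t) = refl
pren-ren ρ π (A ⋀ B)    = cong₂ _⋀_ (pren-ren ρ π A) (pren-ren ρ π B)
pren-ren ρ π (A ⋁ B)    = cong₂ _⋁_ (pren-ren ρ π A) (pren-ren ρ π B)
pren-ren ρ π (A ⟶ B)    = cong₂ _⟶_ (pren-ren ρ π A) (pren-ren ρ π B)
pren-ren ρ π (ex A)     = cong ex (pren-ren (liftR ρ) π A)
pren-ren ρ π (fa A)     = cong fa (pren-ren (liftR ρ) π A)
pren-ren ρ π (que A)    = cong que (pren-ren ρ π A)
pren-ren ρ π (bang A)   = cong bang (pren-ren ρ π A)

pren-psub : ∀ {L s n m Δ Δ' Δ''} (π : PRen Δ' Δ'') (σ : PSub L Δ Δ' n) (w : Ren n m)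
  (A : Fm L s m Δ) → pren π (psub σ w A) ≡ psub (pren π ∘ σ) w A
pren-psub π σ w tru                = refl
pren-psub π σ w fls                = refl
pren-psub π σ w (atom {a = a} x t) = pren-ren ([ lookup t , w ] ∘ splitAt a) π (σ x)
pren-psub π σ w (A ⋀ B)            = cong₂ _⋀_ (pren-psub π σ w A) (pren-psub π σ w B)
pren-psub π σ w (A ⋁ B)            = cong₂ _⋁_ (pren-psub π σ w A) (pren-psub π σ w B)
pren-psub π σ w (A ⟶ B)            = cong₂ _⟶_ (pren-psub π σ w A) (pren-psub π σ w B)
pren-psub π σ w (ex A)             = cong ex (pren-psub π σ (suc ∘ w) A)
pren-psub π σ w (fa A)             = cong fa (pren-psub π σ (suc ∘ w) A)
pren-psub π σ w (que A)            = cong que (pren-psub π σ w A)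
pren-psub π σ w (bang A)           = cong bang (pren-psub π σ w A)

psub-pren : ∀ {L s n m Δ Δ' Δ''} (σ : PSub L Δ' Δ'' n) (π : PRen Δ Δ') (w : Ren n m)
  (A : Fm L s m Δ) → psub σ w (pren π A) ≡ psub (σ ∘ π) w A
psub-pren σ π w tru        = refl
psub-pren σ π w fls        = refl
psub-pren σ π w (atom x t) = refl
psub-pren σ π w (A ⋀ B)    = cong₂ _⋀_ (psub-pren σ π w A) (psub-pren σ π w B)
psub-pren σ π w (A ⋁ B)    = cong₂ _⋁_ (psub-pren σ π w A) (psub-pren σ π w B)
psub-pren σ π w (A ⟶ B)    = cong₂ _⟶_ (psub-pren σ π w A) (psub-pren σ π w B)
psub-pren σ π w (ex A)     = cong ex (psub-pren σ π (suc ∘ w) A)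
psub-pren σ π w (fa A)     = cong fa (psub-pren σ π (suc ∘ w) A)
psub-pren σ π w (que A)    = cong que (psub-pren σ π w A)
psub-pren σ π w (bang A)   = cong bang (psub-pren σ π w A)

psub-idS : ∀ {L s n m Δ} (w : Ren n m) (A : Fm L s m Δ) → psub (idS {n = n}) w A ≡ A
psub-idS w tru = refl
psub-idS w fls = refl
psub-idS {n = n} w (atom {a = a} x t) = cong (atom x) (begin
    Vec.map g (tabulate (_↑ˡ n))  ≡⟨ Vec.tabulate-∘ g (_↑ˡ n) ⟨
    tabulate (g ∘ (_↑ˡ n))        ≡⟨ Vec.tabulate-cong (λ i → cong [ lookup t , w ] (splitAt-↑ˡ a i n)) ⟩
    tabulate (lookup t)           ≡⟨ Vec.tabulate∘lookup t ⟩
    t                             ∎)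
  where
  open ≡-Reasoning
  g = [ lookup t , w ] ∘ splitAt a
psub-idS w (A ⋀ B)  = cong₂ _⋀_ (psub-idS w A) (psub-idS w B)
psub-idS w (A ⋁ B)  = cong₂ _⋁_ (psub-idS w A) (psub-idS w B)
psub-idS w (A ⟶ B)  = cong₂ _⟶_ (psub-idS w A) (psub-idS w B)
psub-idS w (ex A)   = cong ex (psub-idS (suc ∘ w) A)
psub-idS w (fa A)   = cong fa (psub-idS (suc ∘ w) A)
psub-idS w (que A)  = cong que (psub-idS w A)
psub-idS w (bang A) = cong bang (psub-idS w A)

psub-single-pren-vs : ∀ {L s n m Δ k a} (A : Fm L s (a + n) Δ) (w : Ren n m) (B : Fm L k m Δ) →
  psub (single A) w (pren vs B) ≡ B
psub-single-pren-vs A w B = trans (psub-pren (single A) vs w B) (psub-idS w B)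

⊢-weaken : ∀ {L n Δ} {Γ Γ' : List (MF L n Δ)} {M} → Γ ⊆ Γ' → Γ ⊢ M → Γ' ⊢ M
⊢-weaken s (hyp p)    = hyp (s p)
⊢-weaken s (&I d e)   = &I (⊢-weaken s d) (⊢-weaken s e)
⊢-weaken s (&E₁ d)    = &E₁ (⊢-weaken s d)
⊢-weaken s (&E₂ d)    = &E₂ (⊢-weaken s d)
⊢-weaken s (⇒I d)     = ⇒I (⊢-weaken (λ { (here e) → here e ; (there p) → there (s p) }) d)
⊢-weaken s (⇒E d e)   = ⇒E (⊢-weaken s d) (⊢-weaken s e)
⊢-weaken s (Π¹I d)    = Π¹I (⊢-weaken (⊆.map⁺ (mren suc) s) d)
⊢-weaken s (Π¹E d t)  = Π¹E (⊢-weaken s d) t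
⊢-weaken s (Π²I d)    = Π²I (⊢-weaken (⊆.map⁺ (mpren vs) s) d)
⊢-weaken s (Π²E d A)  = Π²E (⊢-weaken s d) A

embM : ∀ {n Δ} → MF QH n Δ → MF QHC n Δ
embM (fm h A)   = fm (embS h) (emb A)
embM (M & N)    = embM M & embM N
embM (M ⇒ N)    = embM M ⇒ embM N
embM (Π¹ M)     = Π¹ (embM M)
embM (Π² h a M) = Π² (embS h) a (embM M)

emb-ren : ∀ {s n m Δ} (ρ : Ren n m) (A : Fm QH s n Δ) → emb (ren ρ A) ≡ ren ρ (emb A)
emb-ren ρ tru        = refl
emb-ren ρ fls        = refl
emb-ren ρ (atom x t) = refl
emb-ren ρ (A ⋀ B)    = cong₂ _⋀_ (emb-ren ρ A) (emb-ren ρ B)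
emb-ren ρ (A ⋁ B)    = cong₂ _⋁_ (emb-ren ρ A) (emb-ren ρ B)
emb-ren ρ (A ⟶ B)    = cong₂ _⟶_ (emb-ren ρ A) (emb-ren ρ B)
emb-ren ρ (ex A)     = cong ex (emb-ren (liftR ρ) A)
emb-ren ρ (fa A)     = cong fa (emb-ren (liftR ρ) A)

emb-pren : ∀ {s n Δ Δ'} (π : PRen Δ Δ') (A : Fm QH s n Δ) → emb (pren π A) ≡ pren π (emb A)
emb-pren π tru        = refl
emb-pren π fls        = refl
emb-pren π (atom x t) = refl
emb-pren π (A ⋀ B)    = cong₂ _⋀_ (emb-pren π A) (emb-pren π B)
emb-pren π (A ⋁ B)    = cong₂ _⋁_ (emb-pren π A) (emb-pren π B)
emb-pren π (A ⟶ B)    = cong₂ _⟶_ (emb-pren π A) (emb-pren π B)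
emb-pren π (ex A)     = cong ex (emb-pren π A)
emb-pren π (fa A)     = cong fa (emb-pren π A)

emb-psub : ∀ {s n m Δ Δ'} (σ : PSub QH Δ Δ' n) (σ' : PSub QHC Δ Δ' n) →
  (∀ {s a} (x : Var Δ s a) → σ' x ≡ emb (σ x)) →
  (w : Ren n m) (A : Fm QH s m Δ) → emb (psub σ w A) ≡ psub σ' w (emb A)
emb-psub σ σ' c w tru                = refl
emb-psub σ σ' c w fls                = refl
emb-psub σ σ' c w (atom {a = a} x t) =
  trans (emb-ren _ (σ x)) (cong (ren ([ lookup t , w ] ∘ splitAt a)) (sym (c x)))
emb-psub σ σ' c w (A ⋀ B)            = cong₂ _⋀_ (emb-psub σ σ' c w A) (emb-psub σ σ' c w B)
emb-psub σ σ' c w (A ⋁ B)            = cong₂ _⋁_ (emb-psub σ σ' c w A) (emb-psub σ σ' c w B)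
emb-psub σ σ' c w (A ⟶ B)            = cong₂ _⟶_ (emb-psub σ σ' c w A) (emb-psub σ σ' c w B)
emb-psub σ σ' c w (ex A)             = cong ex (emb-psub σ σ' c (suc ∘ w) A)
emb-psub σ σ' c w (fa A)             = cong fa (emb-psub σ σ' c (suc ∘ w) A)

embM-mren : ∀ {n m Δ} (ρ : Ren n m) (M : MF QH n Δ) → embM (mren ρ M) ≡ mren ρ (embM M)
embM-mren ρ (fm h A)   = cong (fm (embS h)) (emb-ren ρ A)
embM-mren ρ (M & N)    = cong₂ _&_ (embM-mren ρ M) (embM-mren ρ N)
embM-mren ρ (M ⇒ N)    = cong₂ _⇒_ (embM-mren ρ M) (embM-mren ρ N)
embM-mren ρ (Π¹ M)     = cong Π¹ (embM-mren (liftR ρ) M)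
embM-mren ρ (Π² h a M) = cong (Π² (embS h) a) (embM-mren ρ M)

embM-mpren : ∀ {n Δ Δ'} (π : PRen Δ Δ') (M : MF QH n Δ) → embM (mpren π M) ≡ mpren π (embM M)
embM-mpren π (fm h A)   = cong (fm (embS h)) (emb-pren π A)
embM-mpren π (M & N)    = cong₂ _&_ (embM-mpren π M) (embM-mpren π N)
embM-mpren π (M ⇒ N)    = cong₂ _⇒_ (embM-mpren π M) (embM-mpren π N)
embM-mpren π (Π¹ M)     = cong Π¹ (embM-mpren π M)
embM-mpren π (Π² h a M) = cong (Π² (embS h) a) (embM-mpren (liftP π) M)

embM-mpsub : ∀ {n m Δ Δ'} (σ : PSub QH Δ Δ' n) (σ' : PSub QHC Δ Δ' n) →
  (∀ {s a} (x : Var Δ s a) → σ' x ≡ emb (σ x)) →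
  (w : Ren n m) (M : MF QH m Δ) → embM (mpsub σ w M) ≡ mpsub σ' w (embM M)
embM-mpsub σ σ' c w (fm h A)   = cong (fm (embS h)) (emb-psub σ σ' c w A)
embM-mpsub σ σ' c w (M & N)    = cong₂ _&_ (embM-mpsub σ σ' c w M) (embM-mpsub σ σ' c w N)
embM-mpsub σ σ' c w (M ⇒ N)    = cong₂ _⇒_ (embM-mpsub σ σ' c w M) (embM-mpsub σ σ' c w N)
embM-mpsub σ σ' c w (Π¹ M)     = cong Π¹ (embM-mpsub σ σ' c (suc ∘ w) M)
embM-mpsub σ σ' c w (Π² h a M) = cong (Π² (embS h) a) (embM-mpsub (liftS σ) (liftS σ') c' w M)
  where
  c' : ∀ {s a} (x : Var _ s a) → liftS σ' x ≡ emb (liftS σ x)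
  c' vz     = refl
  c' (vs x) = trans (cong (pren vs) (c x)) (sym (emb-pren vs (σ x)))

embM-⊢ : ∀ {n Δ} {Γ : List (MF QH n Δ)} {M} → Γ ⊢ M → map embM Γ ⊢ embM M
embM-⊢ (hyp p)   = hyp (∈-map⁺ embM p)
embM-⊢ (&I d e)  = &I (embM-⊢ d) (embM-⊢ e)
embM-⊢ (&E₁ d)   = &E₁ (embM-⊢ d)
embM-⊢ (&E₂ d)   = &E₂ (embM-⊢ d)
embM-⊢ (⇒I d)    = ⇒I (embM-⊢ d)
embM-⊢ (⇒E d e)  = ⇒E (embM-⊢ d) (embM-⊢ e)
embM-⊢ {Γ = Γ} (Π¹I d) = Π¹I (subst (_⊢ _) (map-commute (embM-mren suc) Γ) (embM-⊢ d))
embM-⊢ (Π¹E {M = M} d t) = subst (_ ⊢_) (sym (embM-mren (inst t) M)) (Π¹E (embM-⊢ d) t)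
embM-⊢ {Γ = Γ} (Π²I {h = qh-i} d) =
  Π²I (subst (_⊢ _) (map-commute (embM-mpren vs) Γ) (embM-⊢ d))
embM-⊢ (Π²E {h = qh-i} {M = M} d A) =
  subst (_ ⊢_) (sym (embM-mpsub (single A) (single (emb A)) c id M)) (Π²E (embM-⊢ d) (emb A))
  where
  c : ∀ {s a} (x : Var _ s a) → single (emb A) x ≡ emb (single A x)
  c vz     = refl
  c (vs x) = refl

-- D QHC contains Dint qhc-i, which is the image of D QH.
embM-Prov : ∀ (X : MF QH 0 []) → Prov QH X → Prov QHC (embM X)
embM-Prov X (k , d) = k , ⇒I (subst (mren (λ ()) (D QHC) ∷ [] ⊢_) (embM-mren (λ ()) X)
  (⇒E (⊢-weaken (λ ()) (embM-⊢ d)) (&E₁ (&E₂ (hyp (here refl))))))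

data Erasure : PCtx → PCtx → Set where
  []   : Erasure [] []
  cons : ∀ {Δ Δ' s a} → Erasure Δ Δ' → Erasure ((s , a) ∷ Δ) ((isort , a) ∷ Δ')

eraseVar : ∀ {Δ Δ' s a} → Erasure Δ Δ' → Var Δ s a → Var Δ' isort a
eraseVar (cons R) vz     = vz
eraseVar (cons R) (vs x) = vs (eraseVar R x)

nn : ∀ {L s n Δ} → Fm L s n Δ → Fm L s n Δ
nn A = neg (neg A)

-- The outer ¬¬ of Kuroda's translation of a c-formula is added by τM.
τ : ∀ {s n Δ Δ'} → Erasure Δ Δ' → Fm QHC s n Δ → Fm QH isort n Δ'
τ R tru          = tru
τ R fls          = fls
τ R (atom x t)   = atom (eraseVar R x) t
τ R (A ⋀ B)      = τ R A ⋀ τ R B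
τ R (A ⋁ B)      = τ R A ⋁ τ R B
τ R (A ⟶ B)      = τ R A ⟶ τ R B
τ R (ex A)       = ex (τ R A)
τ {csort} R (fa A) = fa (nn (τ R A))
τ {isort} R (fa A) = fa (τ R A)
τ R (que A)      = τ R A
τ R (bang A)     = nn (τ R A)

τM : ∀ {n Δ Δ'} → Erasure Δ Δ' → MF QHC n Δ → MF QH n Δ'
τM R (fm qhc-c A) = fm qh-i (nn (τ R A))
τM R (fm qhc-i A) = fm qh-i (τ R A)
τM R (M & N)      = τM R M & τM R N
τM R (M ⇒ N)      = τM R M ⇒ τM R N
τM R (Π¹ M)       = Π¹ (τM R M)
τM R (Π² h a M)   = Π² qh-i a (τM (cons R) M)

τ-ren : ∀ {s n m Δ Δ'} (R : Erasure Δ Δ') (ρ : Ren n m) (A : Fm QHC s n Δ) →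
  τ R (ren ρ A) ≡ ren ρ (τ R A)
τ-ren R ρ tru        = refl
τ-ren R ρ fls        = refl
τ-ren R ρ (atom x t) = refl
τ-ren R ρ (A ⋀ B)    = cong₂ _⋀_ (τ-ren R ρ A) (τ-ren R ρ B)
τ-ren R ρ (A ⋁ B)    = cong₂ _⋁_ (τ-ren R ρ A) (τ-ren R ρ B)
τ-ren R ρ (A ⟶ B)    = cong₂ _⟶_ (τ-ren R ρ A) (τ-ren R ρ B)
τ-ren R ρ (ex A)     = cong ex (τ-ren R (liftR ρ) A)
τ-ren {csort} R ρ (fa A) = cong (fa ∘ nn) (τ-ren R (liftR ρ) A)
τ-ren {isort} R ρ (fa A) = cong fa (τ-ren R (liftR ρ) A)
τ-ren R ρ (que A)    = τ-ren R ρ A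
τ-ren R ρ (bang A)   = cong nn (τ-ren R ρ A)

τ-pren : ∀ {s n Δ₁ Δ₂ Δ₁' Δ₂'} (R₁ : Erasure Δ₁ Δ₁') (R₂ : Erasure Δ₂ Δ₂')
  (π : PRen Δ₁ Δ₂) (π' : PRen Δ₁' Δ₂') →
  (∀ {s a} (x : Var Δ₁ s a) → eraseVar R₂ (π x) ≡ π' (eraseVar R₁ x)) →
  (A : Fm QHC s n Δ₁) → τ R₂ (pren π A) ≡ pren π' (τ R₁ A)
τ-pren R₁ R₂ π π' c tru        = refl
τ-pren R₁ R₂ π π' c fls        = refl
τ-pren R₁ R₂ π π' c (atom x t) = cong (λ v → atom v t) (c x)
τ-pren R₁ R₂ π π' c (A ⋀ B)    = cong₂ _⋀_ (τ-pren R₁ R₂ π π' c A) (τ-pren R₁ R₂ π π' c B)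
τ-pren R₁ R₂ π π' c (A ⋁ B)    = cong₂ _⋁_ (τ-pren R₁ R₂ π π' c A) (τ-pren R₁ R₂ π π' c B)
τ-pren R₁ R₂ π π' c (A ⟶ B)    = cong₂ _⟶_ (τ-pren R₁ R₂ π π' c A) (τ-pren R₁ R₂ π π' c B)
τ-pren R₁ R₂ π π' c (ex A)     = cong ex (τ-pren R₁ R₂ π π' c A)
τ-pren {csort} R₁ R₂ π π' c (fa A) = cong (fa ∘ nn) (τ-pren R₁ R₂ π π' c A)
τ-pren {isort} R₁ R₂ π π' c (fa A) = cong fa (τ-pren R₁ R₂ π π' c A)
τ-pren R₁ R₂ π π' c (que A)    = τ-pren R₁ R₂ π π' c A
τ-pren R₁ R₂ π π' c (bang A)   = cong nn (τ-pren R₁ R₂ π π' c A)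

τ-psub : ∀ {s n m Δ₁ Δ₂ Δ₁' Δ₂'} (R₁ : Erasure Δ₁ Δ₁') (R₂ : Erasure Δ₂ Δ₂')
  (σ : PSub QHC Δ₁ Δ₂ n) (σ' : PSub QH Δ₁' Δ₂' n) →
  (∀ {s a} (x : Var Δ₁ s a) → σ' (eraseVar R₁ x) ≡ τ R₂ (σ x)) →
  (w : Ren n m) (A : Fm QHC s m Δ₁) → τ R₂ (psub σ w A) ≡ psub σ' w (τ R₁ A)
τ-psub R₁ R₂ σ σ' c w tru                = refl
τ-psub R₁ R₂ σ σ' c w fls                = refl
τ-psub R₁ R₂ σ σ' c w (atom {a = a} x t) =
  trans (τ-ren R₂ _ (σ x)) (cong (ren ([ lookup t , w ] ∘ splitAt a)) (sym (c x)))
τ-psub R₁ R₂ σ σ' c w (A ⋀ B) = cong₂ _⋀_ (τ-psub R₁ R₂ σ σ' c w A) (τ-psub R₁ R₂ σ σ' c w B)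
τ-psub R₁ R₂ σ σ' c w (A ⋁ B) = cong₂ _⋁_ (τ-psub R₁ R₂ σ σ' c w A) (τ-psub R₁ R₂ σ σ' c w B)
τ-psub R₁ R₂ σ σ' c w (A ⟶ B) = cong₂ _⟶_ (τ-psub R₁ R₂ σ σ' c w A) (τ-psub R₁ R₂ σ σ' c w B)
τ-psub R₁ R₂ σ σ' c w (ex A)  = cong ex (τ-psub R₁ R₂ σ σ' c (suc ∘ w) A)
τ-psub {csort} R₁ R₂ σ σ' c w (fa A) = cong (fa ∘ nn) (τ-psub R₁ R₂ σ σ' c (suc ∘ w) A)
τ-psub {isort} R₁ R₂ σ σ' c w (fa A) = cong fa (τ-psub R₁ R₂ σ σ' c (suc ∘ w) A)
τ-psub R₁ R₂ σ σ' c w (que A)  = τ-psub R₁ R₂ σ σ' c w A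
τ-psub R₁ R₂ σ σ' c w (bang A) = cong nn (τ-psub R₁ R₂ σ σ' c w A)

τM-mren : ∀ {n m Δ Δ'} (R : Erasure Δ Δ') (ρ : Ren n m) (M : MF QHC n Δ) →
  τM R (mren ρ M) ≡ mren ρ (τM R M)
τM-mren R ρ (fm qhc-c A) = cong (fm qh-i ∘ nn) (τ-ren R ρ A)
τM-mren R ρ (fm qhc-i A) = cong (fm qh-i) (τ-ren R ρ A)
τM-mren R ρ (M & N)      = cong₂ _&_ (τM-mren R ρ M) (τM-mren R ρ N)
τM-mren R ρ (M ⇒ N)      = cong₂ _⇒_ (τM-mren R ρ M) (τM-mren R ρ N)
τM-mren R ρ (Π¹ M)       = cong Π¹ (τM-mren R (liftR ρ) M)
τM-mren R ρ (Π² h a M)   = cong (Π² qh-i a) (τM-mren (cons R) ρ M)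

τM-mpren : ∀ {n Δ₁ Δ₂ Δ₁' Δ₂'} (R₁ : Erasure Δ₁ Δ₁') (R₂ : Erasure Δ₂ Δ₂')
  (π : PRen Δ₁ Δ₂) (π' : PRen Δ₁' Δ₂') →
  (∀ {s a} (x : Var Δ₁ s a) → eraseVar R₂ (π x) ≡ π' (eraseVar R₁ x)) →
  (M : MF QHC n Δ₁) → τM R₂ (mpren π M) ≡ mpren π' (τM R₁ M)
τM-mpren R₁ R₂ π π' c (fm qhc-c A) = cong (fm qh-i ∘ nn) (τ-pren R₁ R₂ π π' c A)
τM-mpren R₁ R₂ π π' c (fm qhc-i A) = cong (fm qh-i) (τ-pren R₁ R₂ π π' c A)
τM-mpren R₁ R₂ π π' c (M & N) = cong₂ _&_ (τM-mpren R₁ R₂ π π' c M) (τM-mpren R₁ R₂ π π' c N)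
τM-mpren R₁ R₂ π π' c (M ⇒ N) = cong₂ _⇒_ (τM-mpren R₁ R₂ π π' c M) (τM-mpren R₁ R₂ π π' c N)
τM-mpren R₁ R₂ π π' c (Π¹ M)  = cong Π¹ (τM-mpren R₁ R₂ π π' c M)
τM-mpren R₁ R₂ π π' c (Π² h a M) =
  cong (Π² qh-i a) (τM-mpren (cons R₁) (cons R₂) (liftP π) (liftP π') c' M)
  where
  c' : ∀ {s a} (x : Var _ s a) → eraseVar (cons R₂) (liftP π x) ≡ liftP π' (eraseVar (cons R₁) x)
  c' vz     = refl
  c' (vs x) = cong vs (c x)

τM-mpsub : ∀ {n m Δ₁ Δ₂ Δ₁' Δ₂'} (R₁ : Erasure Δ₁ Δ₁') (R₂ : Erasure Δ₂ Δ₂')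
  (σ : PSub QHC Δ₁ Δ₂ n) (σ' : PSub QH Δ₁' Δ₂' n) →
  (∀ {s a} (x : Var Δ₁ s a) → σ' (eraseVar R₁ x) ≡ τ R₂ (σ x)) →
  (w : Ren n m) (M : MF QHC m Δ₁) → τM R₂ (mpsub σ w M) ≡ mpsub σ' w (τM R₁ M)
τM-mpsub R₁ R₂ σ σ' c w (fm qhc-c A) = cong (fm qh-i ∘ nn) (τ-psub R₁ R₂ σ σ' c w A)
τM-mpsub R₁ R₂ σ σ' c w (fm qhc-i A) = cong (fm qh-i) (τ-psub R₁ R₂ σ σ' c w A)
τM-mpsub R₁ R₂ σ σ' c w (M & N) = cong₂ _&_ (τM-mpsub R₁ R₂ σ σ' c w M) (τM-mpsub R₁ R₂ σ σ' c w N)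
τM-mpsub R₁ R₂ σ σ' c w (M ⇒ N) = cong₂ _⇒_ (τM-mpsub R₁ R₂ σ σ' c w M) (τM-mpsub R₁ R₂ σ σ' c w N)
τM-mpsub R₁ R₂ σ σ' c w (Π¹ M)  = cong Π¹ (τM-mpsub R₁ R₂ σ σ' c (suc ∘ w) M)
τM-mpsub R₁ R₂ σ σ' c w (Π² h a M) =
  cong (Π² qh-i a) (τM-mpsub (cons R₁) (cons R₂) (liftS σ) (liftS σ') c' w M)
  where
  c' : ∀ {s a} (x : Var _ s a) → liftS σ' (eraseVar (cons R₁) x) ≡ τ (cons R₂) (liftS σ x)
  c' vz     = refl
  c' (vs x) = trans (cong (pren vs) (c x)) (sym (τ-pren R₂ (cons R₂) vs vs (λ _ → refl) (σ x)))

τM-⊢ : ∀ {n Δ Δ'} (R : Erasure Δ Δ') {Γ : List (MF QHC n Δ)} {M} → Γ ⊢ M → map (τM R) Γ ⊢ τM R M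
τM-⊢ R (hyp p)  = hyp (∈-map⁺ (τM R) p)
τM-⊢ R (&I d e) = &I (τM-⊢ R d) (τM-⊢ R e)
τM-⊢ R (&E₁ d)  = &E₁ (τM-⊢ R d)
τM-⊢ R (&E₂ d)  = &E₂ (τM-⊢ R d)
τM-⊢ R (⇒I d)   = ⇒I (τM-⊢ R d)
τM-⊢ R (⇒E d e) = ⇒E (τM-⊢ R d) (τM-⊢ R e)
τM-⊢ R {Γ} (Π¹I d) = Π¹I (subst (_⊢ _) (map-commute (τM-mren R suc) Γ) (τM-⊢ R d))
τM-⊢ R (Π¹E {M = M} d t) = subst (_ ⊢_) (sym (τM-mren R (inst t) M)) (Π¹E (τM-⊢ R d) t)
τM-⊢ R {Γ} (Π²I d) =
  Π²I (subst (_⊢ _) (map-commute (τM-mpren R (cons R) vs vs (λ _ → refl)) Γ) (τM-⊢ (cons R) d))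
τM-⊢ R (Π²E {M = M} d A) =
  subst (_ ⊢_) (sym (τM-mpsub (cons R) R (single A) (single (τ R A)) c id M)) (Π²E (τM-⊢ R d) (τ R A))
  where
  c : ∀ {s a} (x : Var _ s a) → single (τ R A) (eraseVar (cons R) x) ≡ τ R (single A x)
  c vz     = refl
  c (vs x) = refl

DQH : ∀ {n Δ} → MF QH n Δ
DQH = mpren (λ ()) (mren (λ ()) (D QH))

p₀ : ∀ {L s n Δ} → Fm L s n ((s , 0) ∷ Δ)
p₀ = atom vz []

p₁ : ∀ {L s n Δ k} → Fm L s n (k ∷ (s , 0) ∷ Δ)
p₁ = atom (vs vz) []

p₂ : ∀ {L s n Δ k k'} → Fm L s n (k ∷ k' ∷ (s , 0) ∷ Δ)
p₂ = atom (vs (vs vz)) []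

θ₀ : ∀ {L s n Δ} → Fm L s (1 + n) ((s , 1) ∷ Δ)
θ₀ = atom vz (zero ∷ [])

θ₁ : ∀ {L s n Δ k} → Fm L s (1 + n) (k ∷ (s , 1) ∷ Δ)
θ₁ = atom (vs vz) (zero ∷ [])

Π⁰ : ∀ {n Δ} → MF QH n ((isort , 0) ∷ Δ) → MF QH n Δ
Π⁰ = Π² qh-i 0

-- Eliminating the predicate quantifiers of an axiom by A, B, C (innermost
-- first) leaves its atoms p₀, p₁, p₂ as ren id A and the left-hand sides below.
inst-p₁ : ∀ {n Δ} (A B : Fm QH isort n Δ) →
  psub (single {s = isort} {a = 0} A) id (ren id (pren vs B)) ≡ B
inst-p₁ A B = trans (cong (psub (single A) id) (ren-id (pren vs B))) (psub-single-pren-vs A id B)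

inst-p₂ : ∀ {n Δ} (A B C : Fm QH isort n Δ) →
  psub (single {s = isort} {a = 0} A) id
    (psub (liftS {k = (isort , 0)} (single {s = isort} {a = 0} B)) id (ren id (pren vs (pren vs C)))) ≡ C
inst-p₂ A B C = begin
  psub (single A) id (psub (liftS (single B)) id (ren id (pren vs (pren vs C))))
    ≡⟨ cong (psub (single A) id ∘ psub (liftS (single B)) id) (ren-id (pren vs (pren vs C))) ⟩
  psub (single A) id (psub (liftS (single B)) id (pren vs (pren vs C)))
    ≡⟨ cong (psub (single A) id) (psub-pren (liftS (single B)) vs id (pren vs C)) ⟩
  psub (single A) id (psub (pren vs ∘ single B) id (pren vs C))
    ≡⟨ cong (psub (single A) id) (pren-psub vs (single B) id (pren vs C)) ⟨
  psub (single A) id (pren vs (psub (single B) id (pren vs C)))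
    ≡⟨ cong (psub (single A) id ∘ pren vs) (psub-single-pren-vs B id C) ⟩
  psub (single A) id (pren vs C)
    ≡⟨ psub-single-pren-vs A id C ⟩
  C ∎
  where open ≡-Reasoning

module Hilbert {n Δ} {Γ : List (MF QH n Δ)} (d : DQH ∈ Γ) where

  Thm : Fm QH isort n Δ → Set
  Thm X = Γ ⊢ fm qh-i X

  axioms : Γ ⊢ DQH
  axioms = hyp d

  axK : Γ ⊢ Π⁰ (Π⁰ (fm qh-i (p₀ ⟶ p₁ ⟶ p₀)))
  axK = &E₁ axioms

  axS : Γ ⊢ Π⁰ (Π⁰ (Π⁰ (fm qh-i ((p₀ ⟶ p₁ ⟶ p₂) ⟶ (p₀ ⟶ p₁) ⟶ p₀ ⟶ p₂))))
  axS = &E₁ (&E₂ axioms)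

  ax∧E₁ : Γ ⊢ Π⁰ (Π⁰ (fm qh-i (p₀ ⋀ p₁ ⟶ p₀)))
  ax∧E₁ = &E₁ (&E₂ (&E₂ axioms))

  ax∧E₂ : Γ ⊢ Π⁰ (Π⁰ (fm qh-i (p₀ ⋀ p₁ ⟶ p₁)))
  ax∧E₂ = &E₁ (&E₂ (&E₂ (&E₂ axioms)))

  ax∧I : Γ ⊢ Π⁰ (Π⁰ (fm qh-i (p₀ ⟶ p₁ ⟶ p₀ ⋀ p₁)))
  ax∧I = &E₁ (&E₂ (&E₂ (&E₂ (&E₂ axioms))))

  ax∨I₁ : Γ ⊢ Π⁰ (Π⁰ (fm qh-i (p₀ ⟶ p₀ ⋁ p₁)))
  ax∨I₁ = &E₁ (&E₂ (&E₂ (&E₂ (&E₂ (&E₂ axioms)))))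

  ax∨I₂ : Γ ⊢ Π⁰ (Π⁰ (fm qh-i (p₁ ⟶ p₀ ⋁ p₁)))
  ax∨I₂ = &E₁ (&E₂ (&E₂ (&E₂ (&E₂ (&E₂ (&E₂ axioms))))))

  ax∨E : Γ ⊢ Π⁰ (Π⁰ (Π⁰ (fm qh-i ((p₀ ⟶ p₂) ⟶ (p₁ ⟶ p₂) ⟶ p₀ ⋁ p₁ ⟶ p₂))))
  ax∨E = &E₁ (&E₂ (&E₂ (&E₂ (&E₂ (&E₂ (&E₂ (&E₂ axioms)))))))

  axEfq : Γ ⊢ Π⁰ (fm qh-i (fls ⟶ p₀))
  axEfq = &E₁ (&E₂ (&E₂ (&E₂ (&E₂ (&E₂ (&E₂ (&E₂ (&E₂ axioms))))))))

  axTru : Γ ⊢ fm qh-i tru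
  axTru = &E₁ (&E₂ (&E₂ (&E₂ (&E₂ (&E₂ (&E₂ (&E₂ (&E₂ (&E₂ axioms)))))))))

  ax∀E : Γ ⊢ Π² qh-i 1 (Π¹ (fm qh-i (fa θ₀ ⟶ θ₀)))
  ax∀E = &E₁ (&E₂ (&E₂ (&E₂ (&E₂ (&E₂ (&E₂ (&E₂ (&E₂ (&E₂ (&E₂ axioms))))))))))

  ax∃I : Γ ⊢ Π² qh-i 1 (Π¹ (fm qh-i (θ₀ ⟶ ex θ₀)))
  ax∃I = &E₁ (&E₂ (&E₂ (&E₂ (&E₂ (&E₂ (&E₂ (&E₂ (&E₂ (&E₂ (&E₂ (&E₂ axioms)))))))))))

  axMP : Γ ⊢ Π⁰ (Π⁰ (fm qh-i p₀ & fm qh-i (p₀ ⟶ p₁) ⇒ fm qh-i p₁))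
  axMP = &E₁ (&E₂ (&E₂ (&E₂ (&E₂ (&E₂ (&E₂ (&E₂ (&E₂ (&E₂ (&E₂ (&E₂ (&E₂ axioms))))))))))))

  ax∀R : Γ ⊢ Π² qh-i 1 (Π⁰ (Π¹ (fm qh-i (p₀ ⟶ θ₁)) ⇒ fm qh-i (p₀ ⟶ fa θ₁)))
  ax∀R = &E₁ (&E₂ (&E₂ (&E₂ (&E₂ (&E₂ (&E₂ (&E₂ (&E₂ (&E₂ (&E₂ (&E₂ (&E₂ (&E₂ axioms)))))))))))))

  ax∃R : Γ ⊢ Π² qh-i 1 (Π⁰ (Π¹ (fm qh-i (θ₁ ⟶ p₀)) ⇒ fm qh-i (ex θ₁ ⟶ p₀)))
  ax∃R = &E₂ (&E₂ (&E₂ (&E₂ (&E₂ (&E₂ (&E₂ (&E₂ (&E₂ (&E₂ (&E₂ (&E₂ (&E₂ (&E₂ axioms)))))))))))))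

  K : ∀ A B → Thm (A ⟶ B ⟶ A)
  K A B = subst Thm (cong₂ _⟶_ (ren-id A) (cong₂ _⟶_ (inst-p₁ A B) (ren-id A)))
    (Π²E (Π²E axK B) A)

  S : ∀ A B C → Thm ((A ⟶ B ⟶ C) ⟶ (A ⟶ B) ⟶ A ⟶ C)
  S A B C = subst Thm
    (cong₂ _⟶_ (cong₂ _⟶_ (ren-id A) (cong₂ _⟶_ (inst-p₁ A B) (inst-p₂ A B C)))
               (cong₂ _⟶_ (cong₂ _⟶_ (ren-id A) (inst-p₁ A B)) (cong₂ _⟶_ (ren-id A) (inst-p₂ A B C))))
    (Π²E (Π²E (Π²E axS C) B) A)

  efq : ∀ A → Thm (fls ⟶ A)
  efq A = subst Thm (cong (fls ⟶_) (ren-id A)) (Π²E axEfq A)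

  ∧I : ∀ A B → Thm (A ⟶ B ⟶ A ⋀ B)
  ∧I A B = subst Thm (cong₂ _⟶_ (ren-id A) (cong₂ _⟶_ (inst-p₁ A B) (cong₂ _⋀_ (ren-id A) (inst-p₁ A B))))
    (Π²E (Π²E ax∧I B) A)

  mp : ∀ {A B} → Thm (A ⟶ B) → Thm A → Thm B
  mp {A} {B} ab a = subst Thm (inst-p₁ A B) (⇒E (Π²E (Π²E axMP B) A)
    (&I (subst Thm (sym (ren-id A)) a) (subst Thm (sym (cong₂ _⟶_ (ren-id A) (inst-p₁ A B))) ab)))

  I : ∀ A → Thm (A ⟶ A)
  I A = mp (mp (S A (A ⟶ A) A) (K A (A ⟶ A))) (K A A)

  -- Bracket abstraction: a context H = ε ,, A₁ ,, … ,, Aₖ stands for the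
  -- hypotheses of H ⇛ B = A₁ ⟶ … ⟶ Aₖ ⟶ B, so that proofs from hypotheses
  -- can be written as combinator terms built from K and S.
  infixl 5 _,,_
  data Cx : Set where
    ε    : Cx
    _,,_ : Cx → Fm QH isort n Δ → Cx

  _⇛_ : Cx → Fm QH isort n Δ → Fm QH isort n Δ
  ε ⇛ B        = B
  (H ,, A) ⇛ B = H ⇛ (A ⟶ B)

  lift : ∀ H {X} → Thm X → Thm (H ⇛ X)
  lift ε x            = x
  lift (H ,, A) {X} x = lift H (mp (K X A) x)

  app : ∀ H {A B} → Thm (H ⇛ (A ⟶ B)) → Thm (H ⇛ A) → Thm (H ⇛ B)
  app ε f a                 = mp f a
  app (H ,, C) {A} {B} f a  = app H (app H (lift H (S C A B)) f) a

  var : ∀ H {A} → Thm ((H ,, A) ⇛ A)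
  var H {A} = lift H (I A)

  wkn : ∀ H {A B} → Thm (H ⇛ A) → Thm ((H ,, B) ⇛ A)
  wkn H {A} {B} x = app H (lift H (K A B)) x

  exfalso : ∀ H {A} → Thm (H ⇛ fls) → Thm (H ⇛ A)
  exfalso H {A} x = app H (lift H (efq A)) x

  ¬¬-intro : ∀ A → Thm (A ⟶ nn A)
  ¬¬-intro A = app (ε ,, A ,, neg A) (var (ε ,, A)) (wkn (ε ,, A) (var ε))

  ¬¬-intro-⊢ : ∀ {A} → Thm A → Thm (nn A)
  ¬¬-intro-⊢ = mp (¬¬-intro _)

  ⟶-trans : ∀ {A B C} → Thm (A ⟶ B) → Thm (B ⟶ C) → Thm (A ⟶ C)
  ⟶-trans {A} f g = app (ε ,, A) (lift (ε ,, A) g) (app (ε ,, A) (lift (ε ,, A) f) (var ε))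

  ¬¬-⟶-intro : ∀ {A B} → Thm (A ⟶ nn B) → Thm (nn (A ⟶ B))
  ¬¬-⟶-intro {A} {B} f = app H₁ (var ε)
      (exfalso H₂ (app H₂ (app H₂ (lift H₂ f) (var H₁))
        (app H₃ (wkn H₂ (wkn H₁ (var ε))) (wkn H₃ (var H₂)))))
    where
    H₁ H₂ H₃ : Cx
    H₁ = ε ,, neg (A ⟶ B)
    H₂ = H₁ ,, A
    H₃ = H₂ ,, B

  ¬¬-⟶-elim : ∀ {A B} → Thm (nn (A ⟶ B)) → Thm (A ⟶ nn B)
  ¬¬-⟶-elim {A} {B} h = app H₂ (lift H₂ h)
      (app H₃ (wkn H₂ (var H₁)) (app H₃ (var H₂) (wkn H₂ (wkn H₁ (var ε)))))
    where
    H₁ H₂ H₃ : Cx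
    H₁ = ε ,, A
    H₂ = H₁ ,, neg B
    H₃ = H₂ ,, (A ⟶ B)

  ¬¬-mp : ∀ A B → Thm (nn (A ⟶ B) ⟶ nn A ⟶ nn B)
  ¬¬-mp A B = app H₃ (wkn H₂ (wkn H₁ (var ε)))
      (app H₄ (wkn H₃ (wkn H₂ (var H₁)))
        (app H₅ (wkn H₄ (wkn H₃ (var H₂))) (app H₅ (wkn H₄ (var H₃)) (var H₄))))
    where
    H₁ H₂ H₃ H₄ H₅ : Cx
    H₁ = ε ,, nn (A ⟶ B)
    H₂ = H₁ ,, nn A
    H₃ = H₂ ,, neg B
    H₄ = H₃ ,, (A ⟶ B)
    H₅ = H₄ ,, A

  ¬¬-mp-⊢ : ∀ {A B} → Thm (nn (A ⟶ B)) → Thm (nn A) → Thm (nn B)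
  ¬¬-mp-⊢ f a = mp (mp (¬¬-mp _ _) f) a

  ¬¬-stable : ∀ A → Thm (nn (nn A ⟶ A))
  ¬¬-stable A = ¬¬-⟶-intro (I _)

  ¬¬⊥-elim : Thm (nn fls ⟶ fls)
  ¬¬⊥-elim = app (ε ,, nn fls) (var ε) (lift (ε ,, nn fls) (I fls))

  ¬¬⟷-refl : ∀ A → Thm (nn ((A ⟶ A) ⋀ (A ⟶ A)))
  ¬¬⟷-refl A = ¬¬-intro-⊢ (mp (mp (∧I _ _) (I A)) (I A))

DQH-∈-mpren : ∀ {n Δ k} {Γ : List (MF QH n Δ)} → DQH ∈ Γ → DQH {n} {k ∷ Δ} ∈ map (mpren vs) Γ
DQH-∈-mpren = ∈-map⁺ (mpren vs)

DQH-∈-mren : ∀ {n Δ} {Γ : List (MF QH n Δ)} → DQH ∈ Γ → DQH {1 + n} {Δ} ∈ map (mren suc) Γ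
DQH-∈-mren = ∈-map⁺ (mren suc)

module _ {n Δ} {Γ : List (MF QH n Δ)} (d : DQH ∈ Γ) where

  private
    module H⁰  = Hilbert (DQH-∈-mpren {k = isort , 0} d)
    module H⁰⁰ = Hilbert (DQH-∈-mpren {k = isort , 0} (DQH-∈-mpren {k = isort , 0} d))
    module H⁰⁰⁰ = Hilbert (DQH-∈-mpren {k = isort , 0} (DQH-∈-mpren {k = isort , 0}
                            (DQH-∈-mpren {k = isort , 0} d)))
    module H¹  = Hilbert (DQH-∈-mpren {k = isort , 1} d)
    module H¹¹ = Hilbert (DQH-∈-mren (DQH-∈-mpren {k = isort , 1} d))

  τ-K : Γ ⊢ Π⁰ (Π⁰ (fm qh-i (nn (p₀ ⟶ p₁ ⟶ p₀))))
  τ-K = Π²I (Π²I (H⁰⁰.¬¬-intro-⊢ (Π²E (Π²E H⁰⁰.axK p₁) p₀)))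

  τ-S : Γ ⊢ Π⁰ (Π⁰ (Π⁰ (fm qh-i (nn ((p₀ ⟶ p₁ ⟶ p₂) ⟶ (p₀ ⟶ p₁) ⟶ p₀ ⟶ p₂)))))
  τ-S = Π²I (Π²I (Π²I (H⁰⁰⁰.¬¬-intro-⊢ (Π²E (Π²E (Π²E H⁰⁰⁰.axS p₂) p₁) p₀))))

  τ-∧E₁ : Γ ⊢ Π⁰ (Π⁰ (fm qh-i (nn (p₀ ⋀ p₁ ⟶ p₀))))
  τ-∧E₁ = Π²I (Π²I (H⁰⁰.¬¬-intro-⊢ (Π²E (Π²E H⁰⁰.ax∧E₁ p₁) p₀)))

  τ-∧E₂ : Γ ⊢ Π⁰ (Π⁰ (fm qh-i (nn (p₀ ⋀ p₁ ⟶ p₁))))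
  τ-∧E₂ = Π²I (Π²I (H⁰⁰.¬¬-intro-⊢ (Π²E (Π²E H⁰⁰.ax∧E₂ p₁) p₀)))

  τ-∧I : Γ ⊢ Π⁰ (Π⁰ (fm qh-i (nn (p₀ ⟶ p₁ ⟶ p₀ ⋀ p₁))))
  τ-∧I = Π²I (Π²I (H⁰⁰.¬¬-intro-⊢ (Π²E (Π²E H⁰⁰.ax∧I p₁) p₀)))

  τ-∨I₁ : Γ ⊢ Π⁰ (Π⁰ (fm qh-i (nn (p₀ ⟶ p₀ ⋁ p₁))))
  τ-∨I₁ = Π²I (Π²I (H⁰⁰.¬¬-intro-⊢ (Π²E (Π²E H⁰⁰.ax∨I₁ p₁) p₀)))

  τ-∨I₂ : Γ ⊢ Π⁰ (Π⁰ (fm qh-i (nn (p₁ ⟶ p₀ ⋁ p₁))))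
  τ-∨I₂ = Π²I (Π²I (H⁰⁰.¬¬-intro-⊢ (Π²E (Π²E H⁰⁰.ax∨I₂ p₁) p₀)))

  τ-∨E : Γ ⊢ Π⁰ (Π⁰ (Π⁰ (fm qh-i (nn ((p₀ ⟶ p₂) ⟶ (p₁ ⟶ p₂) ⟶ p₀ ⋁ p₁ ⟶ p₂)))))
  τ-∨E = Π²I (Π²I (Π²I (H⁰⁰⁰.¬¬-intro-⊢ (Π²E (Π²E (Π²E H⁰⁰⁰.ax∨E p₂) p₁) p₀))))

  τ-efq : Γ ⊢ Π⁰ (fm qh-i (nn (fls ⟶ p₀)))
  τ-efq = Π²I (H⁰.¬¬-intro-⊢ (Π²E H⁰.axEfq p₀))

  τ-tru : Γ ⊢ fm qh-i (nn tru)
  τ-tru = Hilbert.¬¬-intro-⊢ d (Hilbert.axTru d)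

  τ-∀E : Γ ⊢ Π² qh-i 1 (Π¹ (fm qh-i (nn (fa (nn θ₀) ⟶ θ₀))))
  τ-∀E = Π²I (Π¹I (H¹¹.¬¬-⟶-intro (Π¹E (Π²E H¹¹.ax∀E (nn θ₀)) zero)))

  τ-∃I : Γ ⊢ Π² qh-i 1 (Π¹ (fm qh-i (nn (θ₀ ⟶ ex θ₀))))
  τ-∃I = Π²I (Π¹I (H¹¹.¬¬-intro-⊢ (Π¹E (Π²E H¹¹.ax∃I θ₀) zero)))

  τ-MP : Γ ⊢ Π⁰ (Π⁰ (fm qh-i (nn p₀) & fm qh-i (nn (p₀ ⟶ p₁)) ⇒ fm qh-i (nn p₁)))
  τ-MP = Π²I (Π²I (⇒I (¬¬-mp-⊢ (&E₂ (hyp (here refl))) (&E₁ (hyp (here refl))))))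
    where open Hilbert (there (DQH-∈-mpren {k = isort , 0} (DQH-∈-mpren {k = isort , 0} d)))

  -- ¬¬ does not commute with ∀ in QH; Kuroda's ¬¬ after ∀ is what makes this work.
  τ-∀R : Γ ⊢ Π² qh-i 1 (Π⁰ (Π¹ (fm qh-i (nn (p₀ ⟶ θ₁))) ⇒ fm qh-i (nn (p₀ ⟶ fa (nn θ₁)))))
  τ-∀R = Π²I (Π²I (⇒I (H.¬¬-intro-⊢ (⇒E (Π²E (Π²E H.ax∀R (nn θ₁)) p₀)
           (Π¹I (H′.¬¬-⟶-elim (Π¹E (hyp (here refl)) zero)))))))
    where
    d⁰¹ : DQH ∈ Π¹ (fm qh-i (nn (p₀ ⟶ θ₁))) ∷ map (mpren vs) (map (mpren vs) Γ)
    d⁰¹ = there (DQH-∈-mpren (DQH-∈-mpren d))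
    module H  = Hilbert d⁰¹
    module H′ = Hilbert (DQH-∈-mren d⁰¹)

  τ-∃R : Γ ⊢ Π² qh-i 1 (Π⁰ (Π¹ (fm qh-i (nn (θ₁ ⟶ p₀))) ⇒ fm qh-i (nn (ex θ₁ ⟶ p₀))))
  τ-∃R = Π²I (Π²I (⇒I (H.¬¬-⟶-intro (⇒E (Π²E (Π²E H.ax∃R θ₁) (nn p₀))
           (Π¹I (H′.¬¬-⟶-elim (Π¹E (hyp (here refl)) zero)))))))
    where
    d⁰¹ : DQH ∈ Π¹ (fm qh-i (nn (θ₁ ⟶ p₀))) ∷ map (mpren vs) (map (mpren vs) Γ)
    d⁰¹ = there (DQH-∈-mpren (DQH-∈-mpren d))
    module H  = Hilbert d⁰¹
    module H′ = Hilbert (DQH-∈-mren d⁰¹)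

  τ-stable : Γ ⊢ Π⁰ (fm qh-i (nn (nn p₀ ⟶ p₀)))
  τ-stable = Π²I (H⁰.¬¬-stable p₀)

  τ-?∧ : Γ ⊢ Π⁰ (Π⁰ (fm qh-i (nn ((p₀ ⋀ p₁ ⟶ p₀ ⋀ p₁) ⋀ (p₀ ⋀ p₁ ⟶ p₀ ⋀ p₁)))))
  τ-?∧ = Π²I (Π²I (H⁰⁰.¬¬⟷-refl _))

  τ-?∨ : Γ ⊢ Π⁰ (Π⁰ (fm qh-i (nn ((p₀ ⋁ p₁ ⟶ p₀ ⋁ p₁) ⋀ (p₀ ⋁ p₁ ⟶ p₀ ⋁ p₁)))))
  τ-?∨ = Π²I (Π²I (H⁰⁰.¬¬⟷-refl _))

  τ-?⟶ : Γ ⊢ Π⁰ (Π⁰ (fm qh-i (nn ((p₀ ⟶ p₁) ⟶ (p₀ ⟶ p₁)))))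
  τ-?⟶ = Π²I (Π²I (H⁰⁰.¬¬-intro-⊢ (H⁰⁰.I _)))

  τ-¬?⋏ : Γ ⊢ fm qh-i (nn (fls ⟶ fls))
  τ-¬?⋏ = Hilbert.¬¬-intro-⊢ d (Hilbert.I d fls)

  τ-?∃ : Γ ⊢ Π² qh-i 1 (fm qh-i (nn ((ex θ₀ ⟶ ex θ₀) ⋀ (ex θ₀ ⟶ ex θ₀))))
  τ-?∃ = Π²I (H¹.¬¬⟷-refl _)

  τ-?∀ : Γ ⊢ Π² qh-i 1 (fm qh-i (nn (fa θ₀ ⟶ fa (nn θ₀))))
  τ-?∀ = Π²I (H¹.¬¬-intro-⊢ (⇒E (Π²E (Π²E H¹.ax∀R (nn θ₀)) (fa θ₀))
           (Π¹I (H¹¹.⟶-trans (Π¹E (Π²E H¹¹.ax∀E θ₀) zero) (H¹¹.¬¬-intro _)))))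

  τ-γ⟶!?γ : Γ ⊢ Π⁰ (fm qh-i (p₀ ⟶ nn p₀))
  τ-γ⟶!?γ = Π²I (H⁰.¬¬-intro _)

  τ-¬!⊥ : Γ ⊢ fm qh-i (nn fls ⟶ fls)
  τ-¬!⊥ = Hilbert.¬¬⊥-elim d

  τ-!p⟶!?!p : Γ ⊢ Π⁰ (fm qh-i (nn p₀ ⟶ nn (nn p₀)))
  τ-!p⟶!?!p = Π²I (H⁰.¬¬-intro _)

  τ-!⟶ : Γ ⊢ Π⁰ (Π⁰ (fm qh-i (nn (p₀ ⟶ p₁) ⟶ nn p₀ ⟶ nn p₁)))
  τ-!⟶ = Π²I (Π²I (H⁰⁰.¬¬-mp _ _))

  τ-!p/p : Γ ⊢ Π⁰ (fm qh-i (nn p₀) ⇒ fm qh-i (nn p₀))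
  τ-!p/p = Π²I (⇒I (hyp (here refl)))

τM-DQHC : ∀ {n} {Γ : List (MF QH n [])} → DQH ∈ Γ → Γ ⊢ τM [] (mren (λ ()) (D QHC))
τM-DQHC d =
  &I (&I (&I (τ-K d) (&I (τ-S d) (&I (τ-∧E₁ d) (&I (τ-∧E₂ d) (&I (τ-∧I d) (&I (τ-∨I₁ d)
     (&I (τ-∨I₂ d) (&I (τ-∨E d) (&I (τ-efq d) (&I (τ-tru d) (&I (τ-∀E d) (&I (τ-∃I d)
     (&I (τ-MP d) (&I (τ-∀R d) (τ-∃R d)))))))))))))))
     (τ-stable d))
  (&I (hyp d)
  (&I (τ-?∧ d) (&I (τ-?∨ d) (&I (τ-?⟶ d) (&I (τ-¬?⋏ d) (&I (τ-?∃ d) (&I (τ-?∀ d)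
     (&I (τ-γ⟶!?γ d) (&I (τ-¬!⊥ d) (&I (τ-stable d) (&I (τ-!p⟶!?!p d) (&I (τ-!⟶ d)
     (&I (τ-!p/p d) (τ-!p/p d))))))))))))))

τ-Prov : ∀ (X : MF QHC 0 []) → Prov QHC X → Prov QH (τM [] X)
τ-Prov X (k , d) = k , ⇒I (subst (mren (λ ()) (D QH) ∷ [] ⊢_) (τM-mren [] (λ ()) X)
  (⇒E (⊢-weaken (λ ()) (τM-⊢ [] d)) (τM-DQHC (here refl))))

Erasure-refl : ∀ {Δ} → OkCtx QH Δ → Erasure Δ Δ
Erasure-refl []          = []
Erasure-refl (qh-i ∷ ok) = cons (Erasure-refl ok)

eraseVar-refl : ∀ {Δ a} (ok : OkCtx QH Δ) (x : Var Δ isort a) → eraseVar (Erasure-refl ok) x ≡ x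
eraseVar-refl (qh-i ∷ ok) vz     = refl
eraseVar-refl (qh-i ∷ ok) (vs x) = cong vs (eraseVar-refl ok x)

τ-emb : ∀ {n Δ} (ok : OkCtx QH Δ) (A : Fm QH isort n Δ) → τ (Erasure-refl ok) (emb A) ≡ A
τ-emb ok tru        = refl
τ-emb ok fls        = refl
τ-emb ok (atom x t) = cong (λ v → atom v t) (eraseVar-refl ok x)
τ-emb ok (A ⋀ B)    = cong₂ _⋀_ (τ-emb ok A) (τ-emb ok B)
τ-emb ok (A ⋁ B)    = cong₂ _⋁_ (τ-emb ok A) (τ-emb ok B)
τ-emb ok (A ⟶ B)    = cong₂ _⟶_ (τ-emb ok A) (τ-emb ok B)
τ-emb ok (ex A)     = cong ex (τ-emb ok A)
τ-emb ok (fa A)     = cong fa (τ-emb ok A)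

τM-close¹ : ∀ {n Δ Δ'} (R : Erasure Δ Δ') (M : MF QHC n Δ) → τM R (close¹ M) ≡ close¹ (τM R M)
τM-close¹ {ℕ.zero}  R M = refl
τM-close¹ {ℕ.suc n} R M = τM-close¹ R (Π¹ M)

embM-close¹ : ∀ {n Δ} (M : MF QH n Δ) → embM (close¹ M) ≡ close¹ (embM M)
embM-close¹ {ℕ.zero}  M = refl
embM-close¹ {ℕ.suc n} M = embM-close¹ (Π¹ M)

τM-close² : ∀ {Δ} (ok : OkCtx QH Δ) (M : MF QHC 0 Δ) →
  τM [] (close² (embOk ok) M) ≡ close² ok (τM (Erasure-refl ok) M)
τM-close² []          M = refl
τM-close² (qh-i ∷ ok) M = τM-close² ok (Π² qhc-i _ M)

embM-close² : ∀ {Δ} (ok : OkCtx QH Δ) (M : MF QH 0 Δ) → embM (close² ok M) ≡ close² (embOk ok) (embM M)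
embM-close² []          M = refl
embM-close² (qh-i ∷ ok) M = embM-close² ok (Π² qh-i _ M)

τM-∀¹ : ∀ {Δ} (ok : OkCtx QH Δ) (F : QHFm Δ) → τM (Erasure-refl ok) (∀¹ (asQHC F)) ≡ ∀¹ (asQH F)
τM-∀¹ ok (n , A) =
  trans (τM-close¹ (Erasure-refl ok) (fm qhc-i (emb A))) (cong (close¹ ∘ fm qh-i) (τ-emb ok A))

embM-∀¹ : ∀ {Δ} (F : QHFm Δ) → embM (∀¹ (asQH F)) ≡ ∀¹ (asQHC F)
embM-∀¹ (n , A) = embM-close¹ (fm qh-i A)

τM-conj : ∀ {Δ} (ok : OkCtx QH Δ) (F : QHFm Δ) (Fs : List (QHFm Δ)) →
  τM (Erasure-refl ok) (conj (∀¹ (asQHC F)) (map ∀¹ (map asQHC Fs)))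
    ≡ conj (∀¹ (asQH F)) (map ∀¹ (map asQH Fs))
τM-conj ok F []        = τM-∀¹ ok F
τM-conj ok F (F' ∷ Fs) = cong₂ _&_ (τM-∀¹ ok F) (τM-conj ok F' Fs)

embM-conj : ∀ {Δ} (F : QHFm Δ) (Fs : List (QHFm Δ)) →
  embM (conj (∀¹ (asQH F)) (map ∀¹ (map asQH Fs))) ≡ conj (∀¹ (asQHC F)) (map ∀¹ (map asQHC Fs))
embM-conj F []        = embM-∀¹ F
embM-conj F (F' ∷ Fs) = cong₂ _&_ (embM-∀¹ F) (embM-conj F' Fs)

τM-rule : ∀ {Δ} (ok : OkCtx QH Δ) (Fs : List (QHFm Δ)) (G : QHFm Δ) →
  τM [] (rule (embOk ok) (map asQHC Fs) (asQHC G)) ≡ rule ok (map asQH Fs) (asQH G)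
τM-rule ok []       G = trans (τM-close² ok _) (cong (close² ok) (τM-∀¹ ok G))
τM-rule ok (F ∷ Fs) G =
  trans (τM-close² ok _) (cong (close² ok) (cong₂ _⇒_ (τM-conj ok F Fs) (τM-∀¹ ok G)))

embM-rule : ∀ {Δ} (ok : OkCtx QH Δ) (Fs : List (QHFm Δ)) (G : QHFm Δ) →
  embM (rule ok (map asQH Fs) (asQH G)) ≡ rule (embOk ok) (map asQHC Fs) (asQHC G)
embM-rule ok []       G = trans (embM-close² ok _) (cong (close² (embOk ok)) (embM-∀¹ G))
embM-rule ok (F ∷ Fs) G =
  trans (embM-close² ok _) (cong (close² (embOk ok)) (cong₂ _⇒_ (embM-conj F Fs) (embM-∀¹ G)))

rule-conservative : ∀ {Δ} (ok : OkCtx QH Δ) (Fs : List (QHFm Δ)) (G : QHFm Δ) →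
  Prov QHC (rule (embOk ok) (map asQHC Fs) (asQHC G)) ⇔ Prov QH (rule ok (map asQH Fs) (asQH G))
rule-conservative ok Fs G = mk⇔
  (subst (Prov QH) (τM-rule ok Fs G) ∘ τ-Prov _)
  (subst (Prov QHC) (embM-rule ok Fs G) ∘ embM-Prov _)

mainTheorem4 :
    (∀ {Δ} (ok : OkCtx QH Δ) (G : QHFm Δ) →
       Prov QHC (principle (embOk ok) (asQHC G)) ⇔ Prov QH (principle ok (asQH G)))
    ×
    (∀ {Δ} (ok : OkCtx QH Δ) (Fs : List (QHFm Δ)) (G : QHFm Δ) →
       Prov QHC (rule (embOk ok) (map asQHC Fs) (asQHC G))
         ⇔ Prov QH (rule ok (map asQH Fs) (asQH G)))
mainTheorem4 = (λ ok G → rule-conservative ok [] G) , rule-conservative
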